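{- Let $\mathcal{A}$ be a weighted pushdown system with state set $Q$ and stack alphabet $\Gamma$, let $c_1,c_2$ be configurations and $n\in\mathbb{Z}$, and let $d\in\mathbb{N}$ be the minimal additional stack height among all paths from $c_1$ to $c_2$ with total weight at least $n$. If $d\geq(|Q|\cdot|\Gamma|)^2$, then there exists a path $\pi^*$ from $c_1$ to $c_2$ with additional stack height $d$ that has a pumpable pair $(p_1,p_2)$ with $w(p_1)+w(p_2)>0$.
   Context: A weighted pushdown system (WPS) is $\mathcal{A}=\langle Q,\Gamma,q_0,E,w\rangle$: finite states $Q$, initial state $q_0$, finite stack alphabet $\Gamma$ with bottom symbol $\bot$ (never pushed or popped), finite edge set $E\subseteq(Q\times\Gamma)\times(Q\times\mathrm{Com}(\Gamma))$ with $\mathrm{Com}(\Gamma)=\{\mathit{skip},\mathit{pop}\}\cup\{\mathit{push}(z)\mid z\in\Gamma\}$, and $w:E\to\mathbb{Z}$. Configurations are $(\alpha,q)$, $\alpha\in\Gamma^+$; $(\alpha',q')$ is a successor of $(\alpha,q)$ if some edge $(q,\gamma,q',\mathit{com})$ has $\gamma$ the top of $\alpha$ and $\alpha'=\mathit{com}(\alpha)$. A path is a sequence of configurations each a successor of the previous, equivalently a start configuration followed by edges; the weight $w$ of a path or of an edge sequence is the sum of its edge weights. For a finite path $\pi=\langle(\alpha_1,q_1),\dots,(\alpha_n,q_n)\rangle$, $\mathrm{ASH}(\pi)=\max_i|\alpha_i|-\max\{|\alpha_1|,|\alpha_n|\}$ is its additional stack height. A pumpable pair for a path $\pi=\langle c_1e_1e_2\dots\rangle$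 is a pair of nonempty contiguous edge segments $p_1=e_{i_1}\dots e_{i_1+n_1}$, $p_2=e_{i_2}\dots e_{i_2+n_2}$ with $i_2>i_1+n_1$ such that for every $j\ge0$ replacing $p_1$ by $p_1^j$ and $p_2$ by $p_2^j$ in $\pi$ yields a valid path from $c_1$. -}

module Defs where

open import Data.Nat using (ℕ; _⊔_; _∸_; _≤_)
open import Data.Integer using (ℤ; _<_) renaming (_+_ to _+ℤ_; _≤_ to _≤ℤ_; 0ℤ to 0ℤ)
open import Data.Fin using (Fin; _≟_)
open import Data.List using (List; []; _∷_; _++_; concat; replicate; foldr; map)
open import Data.List.NonEmpty using (List⁺; _∷_; _∷⁺_; head; last)
import Data.List.NonEmpty as L⁺
open import Data.List.Membership.Propositional using (_∈_)
open import Data.List.Relation.Unary.All using (All)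
open import Data.Maybe using (Maybe; just; nothing; maybe)
import Data.Maybe as M
open import Data.Product using (Σ; ∃; ∃-syntax; _×_; _,_)
open import Relation.Binary.PropositionalEquality using (_≡_; _≢_)
open import Relation.Nullary using (yes; no)

data Com (nΓ : ℕ) : Set where
  skip : Com nΓ
  pop  : Com nΓ
  push : Fin nΓ → Com nΓ

record Edge (nQ nΓ : ℕ) : Set where
  constructor edge
  field
    src : Fin nQ
    top : Fin nΓ
    tgt : Fin nQ
    com : Com nΓ
open Edge public

record WPS : Set where
  field
    nQ  : ℕ
    nΓ  : ℕ
    q₀  : Fin nQ
    bot : Fin nΓ
    E   : List (Edge nQ nΓ)
    w   : Edge nQ nΓ → ℤ
    never-push-bot : ∀ {e} → e ∈ E → com e ≢ push bot
    never-pop-bot  : ∀ {e} → e ∈ E → top e ≡ bot → com e ≢ pop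
open WPS public

-- Configurations (α, q) with α ∈ Γ⁺ ; the head of α is the top of the stack.
record Config (A : WPS) : Set where
  constructor ⟨_,_⟩
  field
    stack : List⁺ (Fin (nΓ A))
    state : Fin (nQ A)
open Config public

height : ∀ {A} → Config A → ℕ
height c = L⁺.length (stack c)

applyCom : ∀ {n} → Com n → List⁺ (Fin n) → Maybe (List⁺ (Fin n))
applyCom skip     α              = just α
applyCom pop      (x ∷ [])       = nothing
applyCom pop      (x ∷ (y ∷ ys)) = just (y ∷ ys)
applyCom (push z) α              = just (z ∷⁺ α)

step : ∀ {A} → Edge (nQ A) (nΓ A) → Config A → Maybe (Config A)
step e ⟨ α , q ⟩ with src e ≟ q | top e ≟ head α
... | yes _ | yes _ = M.map (λ α' → ⟨ α' , tgt e ⟩) (applyCom (com e) α)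
... | _     | _     = nothing

-- The configurations visited after the start configuration, if the edge sequence is executable.
trace : ∀ {A} → Config A → List (Edge (nQ A) (nΓ A)) → Maybe (List (Config A))
trace c [] = just []
trace c (e ∷ es) with step e c
... | nothing = nothing
... | just c' = M.map (c' ∷_) (trace c' es)

ValidFrom : (A : WPS) → Config A → List (Edge (nQ A) (nΓ A)) → Set
ValidFrom A c es = All (_∈ E A) es × ∃[ cs ] (trace c es ≡ just cs)

PathFromTo : (A : WPS) → Config A → List (Edge (nQ A) (nΓ A)) → Config A → Set
PathFromTo A c es c' =
  All (_∈ E A) es × ∃[ cs ] (trace c es ≡ just cs × last (c ∷ cs) ≡ c')

weight : (A : WPS) → List (Edge (nQ A) (nΓ A)) → ℤ
weight A es = foldr (λ e s → w A e +ℤ s) 0ℤ es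

maxHeight : ∀ {A} → List (Config A) → ℕ
maxHeight cs = foldr (λ c m → height c ⊔ m) 0 cs

ashConfigs : ∀ {A} → Config A → List (Config A) → ℕ
ashConfigs c cs = maxHeight (c ∷ cs) ∸ (height c ⊔ height (last (c ∷ cs)))

-- Additional stack height of the path from c along es (0 if not executable; only used on paths).
ASH : (A : WPS) → Config A → List (Edge (nQ A) (nΓ A)) → ℕ
ASH A c es = maybe (ashConfigs c) 0 (trace c es)

rep : ∀ {a} {X : Set a} → ℕ → List X → List X
rep j p = concat (replicate j p)

PumpablePair : (A : WPS) → Config A → (es p₁ p₂ : List (Edge (nQ A) (nΓ A))) → Set
PumpablePair A c es p₁ p₂ =
  Σ (List (Edge (nQ A) (nΓ A))) λ a →
  Σ (List (Edge (nQ A) (nΓ A))) λ b →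
  Σ (List (Edge (nQ A) (nΓ A))) λ r →
    (es ≡ a ++ p₁ ++ b ++ p₂ ++ r) × (p₁ ≢ []) × (p₂ ≢ []) ×
    (∀ (j : ℕ) → ValidFrom A c (a ++ rep j p₁ ++ b ++ rep j p₂ ++ r))

IsMinASH : (A : WPS) → Config A → Config A → ℤ → ℕ → Set
IsMinASH A c₁ c₂ n d =
  (∃[ es ] (PathFromTo A c₁ es c₂ × n ≤ℤ weight A es × ASH A c₁ es ≡ d)) ×
  (∀ es → PathFromTo A c₁ es c₂ → n ≤ℤ weight A es → d ≤ ASH A c₁ es)

module Submission where

-- A well-matched stretch of a path starts in state q with γ on top, never touches the stack below
-- γ, and ends in state q' with the same stack; its level is the triple (γ, q, q'). There are
-- M = |Q|·|Γ|·|Q| ≤ (|Q|·|Γ|)² levels.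
--   * A path climbing d above its endpoints contains such a well-matched stretch that itself climbs
--     d + 1 symbols above its base (levelSegment); inside it, the stretch one symbol higher climbs
--     d, and so on: a chain of d + 1 strictly nested stretches (chain).
--   * By pigeonhole two stretches of the chain have the same level (repetition). The parts P and S
--     of the outer one before and after the inner one then form a pumpable pair: Pʲ pushes some
--     word j times and Sʲ pops it again (module Pumping).
--   * If w(P) + w(S) ≤ 0, deleting P and S gives a strictly shorter path of weight ≥ n whose ASH
--     is at most d, hence equal to d by minimality. Induction on the length of a witness path thus
--     ends with a witness whose pumpable pair has positive weight (module Minimal).

open import Defs

module Preliminaries where

  open import Data.Nat using (zero; suc; _<_; _≤_; s≤s; z≤n)
  open import Data.Nat.Properties using (≤-trans; ≤-reflexive; m≤n+m; <⇒≱)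
  open import Data.Integer using () renaming (_+_ to _+ℤ_)
  open import Data.Integer.Solver using (module +-*-Solver)
  open import Data.List using (List; []; _∷_; _++_; length; initLast; _∷ʳ′_)
  open import Data.List.NonEmpty using (_∷_; last)
  open import Data.List.Properties using (++-assoc; ++-identityʳ; length-++; length-++-≤ʳ)
  open import Data.List.Relation.Unary.All using (All)
  open import Data.List.Relation.Unary.All.Properties using (concat⁺; replicate⁺)
  open import Data.Empty using (⊥-elim)
  open import Relation.Binary.PropositionalEquality using (_≡_; _≢_; refl; sym; trans; cong; module ≡-Reasoning)
  open import Data.Fin using (Fin)
  open import Data.Fin.Properties using (pigeonhole; <-irrefl)
  open import Data.Vec using (Vec; lookup)
  open import Data.Vec.Relation.Unary.Unique.Propositional using (Unique)
  open import Data.Vec.Relation.Unary.Unique.Propositional.Properties using (lookup-injective)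
  open import Data.Product using (_,_)
  open import Relation.Nullary using (¬_)

  fin-pos : ∀ {k} → Fin k → 1 ≤ k
  fin-pos {suc _} _ = s≤s z≤n

  unique-short : ∀ {m n} {xs : Vec (Fin m) n} → Unique xs → ¬ m < n
  unique-short {xs = xs} distinct m<n with pigeonhole m<n (lookup xs)
  ... | i , j , i<j , same = <-irrefl (lookup-injective distinct i j same) i<j

  last-∷ : ∀ {X : Set} (x y : X) ys → last (x ∷ y ∷ ys) ≡ last (y ∷ ys)
  last-∷ x y ys with initLast ys
  ... | [] = refl
  ... | _ ∷ʳ′ _ = refl

  nest-split : ∀ {X : Set} {es core : List X} (a b m s r : List X) →
    es ≡ a ++ core ++ r → core ≡ b ++ m ++ s → es ≡ a ++ b ++ m ++ s ++ r
  nest-split {es = es} {core} a b m s r es≡ core≡ = begin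
    es                         ≡⟨ es≡ ⟩
    a ++ core ++ r             ≡⟨ cong (λ t → a ++ t ++ r) core≡ ⟩
    a ++ (b ++ m ++ s) ++ r    ≡⟨ cong (a ++_) (++-assoc b (m ++ s) r) ⟩
    a ++ b ++ (m ++ s) ++ r    ≡⟨ cong (λ t → a ++ b ++ t) (++-assoc m s r) ⟩
    a ++ b ++ m ++ s ++ r      ∎
    where open ≡-Reasoning

  prefix-empty : ∀ {X : Set} (l' l : List X) → length (l' ++ l) ≤ length l → l' ≡ []
  prefix-empty [] l _ = refl
  prefix-empty (z ∷ l') l le = ⊥-elim (<⇒≱ le (length-++-≤ʳ l {l'}))

  length-suffix : ∀ {X : Set} (xs : List X) (y : X) (ys : List X) → length ys < length (xs ++ y ∷ ys)
  length-suffix xs y ys = ≤-trans (m≤n+m (suc (length ys)) (length xs)) (≤-reflexive (sym (length-++ xs)))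

  insert-≤ : ∀ {X : Set} (m ys r : List X) → length (m ++ r) ≤ length (m ++ ys ++ r)
  insert-≤ [] ys r = length-++-≤ʳ r {ys}
  insert-≤ (_ ∷ m) ys r = s≤s (insert-≤ m ys r)

  insert-< : ∀ {X : Set} (a xs m ys r : List X) → xs ≢ [] →
    length (a ++ m ++ r) < length (a ++ xs ++ m ++ ys ++ r)
  insert-< (_ ∷ a) xs m ys r ne = s≤s (insert-< a xs m ys r ne)
  insert-< [] [] m ys r ne = ⊥-elim (ne refl)
  insert-< [] (_ ∷ xs) m ys r _ = s≤s (≤-trans (insert-≤ m ys r) (length-++-≤ʳ (m ++ ys ++ r) {xs}))

  rep-comm : ∀ {X : Set} j (xs : List X) → rep j xs ++ xs ≡ xs ++ rep j xs
  rep-comm zero xs = sym (++-identityʳ xs)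
  rep-comm (suc j) xs = trans (++-assoc xs (rep j xs) xs) (cong (xs ++_) (rep-comm j xs))

  rep-all : ∀ {X : Set} {P : X → Set} j {xs : List X} → All P xs → All P (rep j xs)
  rep-all j all = concat⁺ (replicate⁺ j all)

  -- The identity in ℤ behind "removing both pumped blocks subtracts their weights".
  pump-weight : ∀ a p m s r → a +ℤ (p +ℤ (m +ℤ (s +ℤ r))) ≡ (a +ℤ (m +ℤ r)) +ℤ (p +ℤ s)
  pump-weight = solve 5 (λ a p m s r → a :+ (p :+ (m :+ (s :+ r))) := (a :+ (m :+ r)) :+ (p :+ s)) refl
    where open +-*-Solver

open Preliminaries

module PushdownRuns (A : WPS) where

  open import Data.Nat using (ℕ; zero; suc; _+_; _*_; _^_; _≤_; _<_; _⊔_; _∸_; s≤s; z≤n; s≤s⁻¹)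
  open import Data.Nat.Properties
    using (≤-refl; ≤-trans; ≤-reflexive; ≤-antisym; <⇒≤; <⇒≱; 1+n≰n; n≤1+n; m≤n⇒m≤1+n; m≤m+n;
           m≤n⇒m<n∨m≡n; suc-injective; 0≢1+n; +-suc; +-comm; +-cancelˡ-≤; +-monoʳ-≤; m+[n∸m]≡n;
           m∸n≢0⇒n<m; ∸-monoˡ-≤;
           m≤m⊔n; m≤n⊔m; ⊔-sel; ⊔-assoc; ⊔-identityʳ; ⊔-mono-≤; ⊔-monoʳ-≤;
           *-mono-≤; *-monoʳ-≤; *-identityʳ; m≤m*n; module ≤-Reasoning)
  open import Data.Nat.Induction using (<-wellFounded)
  open import Induction.WellFounded using (Acc; acc)
  open import Data.Integer using (ℤ; 0ℤ) renaming (_+_ to _+ℤ_; _≤_ to _≤ℤ_; _<_ to _<ℤ_)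
  import Data.Integer.Properties as ℤ
  open import Data.Fin using (Fin; _≟_; combine)
  open import Data.Fin.Properties using (combine-injective; nonZeroIndex)
  open import Data.List using (List; []; _∷_; _++_; length; map)
  open import Data.List.NonEmpty using (_∷_; last)
  open import Data.List.Properties using (++-assoc; ++-identityʳ; ++-conicalˡ; ++-conicalʳ; length-++; length-++-≤ʳ)
  open import Data.List.Relation.Unary.All using (All)
  open import Data.List.Relation.Unary.All.Properties using (++⁺) renaming (++⁻ to All-++⁻)
  open import Data.List.Relation.Unary.Any using (Any; here; there)
  import Data.List.Relation.Unary.Any as Any
  open import Data.List.Relation.Unary.Any.Properties using (map⁻; ++⁻)
  open import Data.List.Membership.Propositional using (_∈_)
  open import Data.Vec using (Vec; []; _∷_)
  import Data.Vec.Relation.Unary.All as VecAll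
  open VecAll using ([]; _∷_)
  open import Data.Vec.Relation.Unary.AllPairs using ([]; _∷_)
  open import Data.Vec.Relation.Unary.Unique.Propositional using (Unique)
  open import Data.Maybe using (just; nothing)
  import Data.Maybe as Maybe
  open import Data.Product using (Σ; ∃-syntax; _×_; _,_; proj₁; proj₂)
  open import Data.Sum using (_⊎_; inj₁; inj₂)
  open import Data.Empty using (⊥-elim)
  open import Relation.Binary.PropositionalEquality
  open import Relation.Nullary using (¬_; yes; no)

  Sym = Fin (nΓ A)
  St  = Fin (nQ A)
  Ed  = Edge (nQ A) (nΓ A)
  Cf  = Config A

  sg : Sym → St → Cf
  sg γ q = ⟨ γ ∷ [] , q ⟩

  data Step : Ed → Cf → Cf → Set where
    skip-step : ∀ {q x q' l}   → Step (edge q x q' skip)     ⟨ x ∷ l , q ⟩ ⟨ x ∷ l , q' ⟩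
    push-step : ∀ {q x q' z l} → Step (edge q x q' (push z)) ⟨ x ∷ l , q ⟩ ⟨ z ∷ x ∷ l , q' ⟩
    pop-step  : ∀ {q x q' y l} → Step (edge q x q' pop)      ⟨ x ∷ y ∷ l , q ⟩ ⟨ y ∷ l , q' ⟩

  step-complete : ∀ e c {c'} → step e c ≡ just c' → Step e c c'
  step-complete (edge s t g k) ⟨ x ∷ l , q ⟩ eq with s ≟ q | t ≟ x
  step-complete (edge s t g skip) ⟨ x ∷ l , q ⟩ refl | yes refl | yes refl = skip-step
  step-complete (edge s t g (push z)) ⟨ x ∷ l , q ⟩ refl | yes refl | yes refl = push-step
  step-complete (edge s t g pop) ⟨ x ∷ y ∷ l , q ⟩ refl | yes refl | yes refl = pop-step
  step-complete (edge s t g pop) ⟨ x ∷ [] , q ⟩ () | yes refl | yes refl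
  step-complete (edge s t g k) ⟨ x ∷ l , q ⟩ () | yes _ | no _
  step-complete (edge s t g k) ⟨ x ∷ l , q ⟩ () | no _ | _

  step-enabled : ∀ q x l q' k →
    step {A} (edge q x q' k) ⟨ x ∷ l , q ⟩ ≡ Maybe.map (λ α → ⟨ α , q' ⟩) (applyCom k (x ∷ l))
  step-enabled q x l q' k with q ≟ q | x ≟ x
  ... | yes _ | yes _ = refl
  ... | yes _ | no x≢x = ⊥-elim (x≢x refl)
  ... | no q≢q | _ = ⊥-elim (q≢q refl)

  step-sound : ∀ {e c c'} → Step e c c' → step e c ≡ just c'
  step-sound (skip-step {q} {x} {q'} {l})     = step-enabled q x l q' skip
  step-sound (push-step {q} {x} {q'} {z} {l}) = step-enabled q x l q' (push z)
  step-sound (pop-step {q} {x} {q'} {y} {l})  = step-enabled q x (y ∷ l) q' pop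

  data Run : Cf → List Ed → List Cf → Cf → Set where
    done : ∀ {c} → Run c [] [] c
    next : ∀ {c e c₁ es cs c'} → Step e c c₁ → Run c₁ es cs c' → Run c (e ∷ es) (c₁ ∷ cs) c'

  _++ᴿ_ : ∀ {c xs cs c' ys ds c''} → Run c xs cs c' → Run c' ys ds c'' → Run c (xs ++ ys) (cs ++ ds) c''
  done ++ᴿ r' = r'
  next s r ++ᴿ r' = next s (r ++ᴿ r')

  run-trace : ∀ {c es cs c'} → Run c es cs c' → trace c es ≡ just cs
  run-trace done = refl
  run-trace (next s r) rewrite step-sound s | run-trace r = refl

  run-last : ∀ {c es cs c'} → Run c es cs c' → last (c ∷ cs) ≡ c'
  run-last done = refl
  run-last (next {c} {c₁ = c₁} {cs = cs} s r) = trans (last-∷ c c₁ cs) (run-last r)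

  trace-run : ∀ c es {cs} → trace c es ≡ just cs → Run c es cs (last (c ∷ cs))
  trace-run c [] refl = done
  trace-run c (e ∷ es) eq with step e c in s
  ... | just c₁ with trace c₁ es in t
  ...   | just cs with refl ← eq =
    subst (Run c (e ∷ es) (c₁ ∷ cs)) (sym (last-∷ c c₁ cs)) (next (step-complete e c s) (trace-run c₁ es t))
  trace-run c (e ∷ es) () | just c₁ | nothing
  trace-run c (e ∷ es) () | nothing

  path⇒run : ∀ {c es c'} → PathFromTo A c es c' → Σ (List Cf) λ cs → Run c es cs c'
  path⇒run {c} {es} (_ , cs , tr , lst) = cs , subst (Run c es cs) lst (trace-run c es tr)

  run⇒path : ∀ {c es cs c'} → All (_∈ E A) es → Run c es cs c' → PathFromTo A c es c'
  run⇒path edges r = edges , _ , run-trace r , run-last r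

  run-ASH : ∀ {c es cs c'} → Run c es cs c' → ASH A c es ≡ maxHeight (c ∷ cs) ∸ (height c ⊔ height c')
  run-ASH r rewrite run-trace r | run-last r = refl

  frame : List Sym → Cf → Cf
  frame ys ⟨ x ∷ l , q ⟩ = ⟨ x ∷ (l ++ ys) , q ⟩

  height-frame : ∀ ys c → height (frame ys c) ≡ height c + length ys
  height-frame ys ⟨ x ∷ l , q ⟩ = cong suc (length-++ l)

  -- Steps only inspect the top of the stack, so they are unaffected by a frame below it.
  step-frame : ∀ ys {e c c'} → Step e c c' → Step e (frame ys c) (frame ys c')
  step-frame ys skip-step = skip-step
  step-frame ys push-step = push-step
  step-frame ys pop-step  = pop-step

  run-frame : ∀ ys {c es cs c'} → Run c es cs c' → Run (frame ys c) es (map (frame ys) cs) (frame ys c')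
  run-frame ys done = done
  run-frame ys (next s r) = next (step-frame ys s) (run-frame ys r)

  -- Conversely, a step from a framed configuration either happens above the frame, or it pops the
  -- last symbol above the frame, landing exactly on top of the frame.
  step-unframe : ∀ ys {x l q e c'} → Step e (frame ys ⟨ x ∷ l , q ⟩) c' →
    (Σ Cf λ c'' → c' ≡ frame ys c'' × Step e ⟨ x ∷ l , q ⟩ c'') ⊎ (l ≡ [] × height c' ≡ length ys)
  step-unframe ys {l = []} skip-step = inj₁ (_ , refl , skip-step)
  step-unframe ys {l = []} push-step = inj₁ (_ , refl , push-step)
  step-unframe ys {l = []} pop-step  = inj₂ (refl , refl)
  step-unframe ys {l = _ ∷ _} skip-step = inj₁ (_ , refl , skip-step)
  step-unframe ys {l = _ ∷ _} push-step = inj₁ (_ , refl , push-step)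
  step-unframe ys {l = _ ∷ _} pop-step  = inj₁ (_ , refl , pop-step)

  step-height : ∀ {e c c'} → Step e c c' → height c' ≤ suc (height c)
  step-height skip-step = n≤1+n _
  step-height push-step = ≤-refl
  step-height pop-step  = m≤n⇒m≤1+n (n≤1+n _)

  step-bottom : ∀ {e c c'} → Step e c c' → last (stack c') ≡ last (stack c)
  step-bottom skip-step = refl
  step-bottom (push-step {x = x} {z = z} {l = l}) = last-∷ z x l
  step-bottom (pop-step {x = x} {y = y} {l = l}) = sym (last-∷ x y l)

  run-bottom : ∀ {c es cs c'} → Run c es cs c' → last (stack c') ≡ last (stack c)
  run-bottom done = refl
  run-bottom (next s r) = trans (run-bottom r) (step-bottom s)

  run-nonempty : ∀ {c es cs c'} → Run c es cs c' → height c ≢ height c' → es ≢ []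
  run-nonempty done h≢h _ = h≢h refl
  run-nonempty (next _ _) _ ()

  -- The two ways a run from a framed configuration can go: it stays above the frame all the way,
  -- or it first comes down to a single symbol δ above the frame and then pops δ.
  data Descent (ys : List Sym) (c : Cf) : List Ed → List Cf → Cf → Set where
    stays : ∀ {es cs c'} → Run c es cs c' → Descent ys c es (map (frame ys) cs) (frame ys c')
    exits : ∀ {inside exit outside csIn c₀ csOut c'} {δ : Sym} {q : St} →
      Run c inside csIn ⟨ δ ∷ [] , q ⟩ → Step exit ⟨ δ ∷ ys , q ⟩ c₀ → height c₀ ≡ length ys →
      Run c₀ outside csOut c' →
      Descent ys c (inside ++ exit ∷ outside) (map (frame ys) csIn ++ c₀ ∷ csOut) c'

  descent : ∀ ys x l q {es cs c'} → Run (frame ys ⟨ x ∷ l , q ⟩) es cs c' →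
    Descent ys ⟨ x ∷ l , q ⟩ es cs c'
  descent ys x l q done = stays done
  descent ys x l q (next s r) with step-unframe ys s
  ... | inj₂ (refl , h) = exits done s h r
  ... | inj₁ (⟨ x' ∷ l' , q' ⟩ , refl , s') with descent ys x' l' q' r
  ...   | stays r' = stays (next s' r')
  ...   | exits rIn sExit h rOut = exits (next s' rIn) sExit h rOut

  -- An occurrence of the stretch core inside the run from c₁ along es to c₂: it is entered in
  -- configuration ⟨ γ ∷ W , q ⟩ and left in ⟨ γ ∷ W , q' ⟩.
  record Segment (c₁ : Cf) (es : List Ed) (c₂ : Cf) (γ : Sym) (q q' : St) (core : List Ed) : Set where
    field
      before after : List Ed
      W : List Sym
      csBefore csAfter : List Cf
      split : es ≡ before ++ core ++ after
      runBefore : Run c₁ before csBefore ⟨ γ ∷ W , q ⟩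
      runAfter  : Run ⟨ γ ∷ W , q' ⟩ after csAfter c₂

  Strict : ∀ {c₁ es c₂ γ q q' core} → Segment c₁ es c₂ γ q q' core → Set
  Strict S = Segment.before S ≢ [] × Segment.after S ≢ []

  whole : ∀ {γ q q' core} → Segment (sg γ q) core (sg γ q') γ q q' core
  whole {core = core} = record
    { before = [] ; after = [] ; W = [] ; csBefore = [] ; csAfter = []
    ; split = sym (++-identityʳ core) ; runBefore = done ; runAfter = done }

  _⨾_ : ∀ {c₁ es c₂ γ q q' core δ p p' core'} → Segment c₁ es c₂ γ q q' core →
    Segment (sg γ q) core (sg γ q') δ p p' core' → Segment c₁ es c₂ δ p p' core'
  _⨾_ {core' = core'} S T = record
    { before = before S ++ before T ; after = after T ++ after S ; W = W T ++ W S
    ; csBefore = _ ; csAfter = _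
    ; split = trans (nest-split (before S) (before T) core' (after T) (after S) (split S) (split T))
                    (sym (++-assoc (before S) (before T) _))
    ; runBefore = runBefore S ++ᴿ run-frame (W S) (runBefore T)
    ; runAfter  = run-frame (W S) (runAfter T) ++ᴿ runAfter S }
    where open Segment

  strict-⨾ : ∀ {c₁ es c₂ γ q q' core δ p p' core'} (S : Segment c₁ es c₂ γ q q' core)
    (T : Segment (sg γ q) core (sg γ q') δ p p' core') → Strict T → Strict (S ⨾ T)
  strict-⨾ S T (b≢[] , a≢[]) =
    (λ eq → b≢[] (++-conicalʳ (before S) (before T) eq)) , (λ eq → a≢[] (++-conicalˡ (after T) (after S) eq))
    where open Segment

  prefix : ∀ {c₀ as cs c₁ es c₂ γ q q' core} → Run c₀ as cs c₁ →
    Segment c₁ es c₂ γ q q' core → Segment c₀ (as ++ es) c₂ γ q q' core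
  prefix {as = as} r S = record
    { before = as ++ before S ; after = after S ; W = W S ; csBefore = _ ; csAfter = csAfter S
    ; split = trans (cong (as ++_) (split S)) (sym (++-assoc as (before S) _))
    ; runBefore = r ++ᴿ runBefore S ; runAfter = runAfter S }
    where open Segment

  -- A segment of a one-symbol stretch sitting on a one-symbol frame needs steps to get up there
  -- and back down.
  strict-above : ∀ {γ q q' core δ p p' core'} (S : Segment (sg γ q) core (sg γ q') δ p p' core') →
    length (Segment.W S) ≡ 1 → Strict S
  strict-above S w≡1 =
    run-nonempty (runBefore S) (λ 1≡ → 0≢1+n (trans (suc-injective 1≡) w≡1)) ,
    run-nonempty (runAfter S) (λ ≡1 → 0≢1+n (trans (suc-injective (sym ≡1)) w≡1))
    where open Segment

  Reaches : ℕ → List Cf → Set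
  Reaches k = Any (λ c → k ≤ height c)

  reaches-max : ∀ c cs {k} → k ≤ maxHeight (c ∷ cs) → Reaches k (c ∷ cs)
  reaches-max c [] le = here (≤-trans le (≤-reflexive (⊔-identityʳ (height c))))
  reaches-max c (c' ∷ cs) {k} le with ⊔-sel (height c) (maxHeight (c' ∷ cs))
  ... | inj₁ eq = here (subst (k ≤_) eq le)
  ... | inj₂ eq = there (reaches-max c' cs (subst (k ≤_) eq le))

  peak-of : ∀ {c₁ es cs c₂} → Run c₁ es cs c₂ → 1 ≤ ASH A c₁ es →
    Reaches (height c₁ ⊔ height c₂ + ASH A c₁ es) (c₁ ∷ cs)
  peak-of {c₁} {es} {cs} {c₂} r pos rewrite run-ASH r =
    reaches-max c₁ cs (≤-reflexive (m+[n∸m]≡n {height c₁ ⊔ height c₂}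
      (<⇒≤ (m∸n≢0⇒n<m λ d≡0 → 1+n≰n (subst (1 ≤_) d≡0 pos)))))

  reaches-unframe : ∀ {m k} ys → length ys ≡ m → ∀ cs →
    Reaches (suc m + k) (map (frame ys) cs) → Reaches (suc k) cs
  reaches-unframe {k = k} ys refl cs peak = Any.map (λ {c} → above-frame c) (map⁻ peak)
    where
      above-frame : ∀ c → suc (length ys) + k ≤ height (frame ys c) → suc k ≤ height c
      above-frame c le = +-cancelˡ-≤ (length ys) (suc k) (height c)
        (subst₂ _≤_ (sym (+-suc (length ys) k)) (trans (height-frame ys c) (+-comm (height c) (length ys))) le)

  -- A well-matched stretch of the run at stack height suc m (its frame W has m symbols) whose own
  -- run climbs to height suc k.
  record HighSegment (c₁ : Cf) (es : List Ed) (c₂ : Cf) (m k : ℕ) : Set where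
    field
      {γ} : Sym
      {q q'} : St
      {core} : List Ed
      {coreConfigs} : List Cf
      segment : Segment c₁ es c₂ γ q q' core
      base : length (Segment.W segment) ≡ m
      coreRun : Run (sg γ q) core coreConfigs (sg γ q')
      peak : Reaches (suc k) (sg γ q ∷ coreConfigs)

  high-prefix : ∀ {c₀ as cs c₁ es c₂ m k} → Run c₀ as cs c₁ → HighSegment c₁ es c₂ m k →
    HighSegment c₀ (as ++ es) c₂ m k
  high-prefix r H = record { segment = prefix r segment ; base = base ; coreRun = coreRun ; peak = peak }
    where open HighSegment H

  -- Follow the run to its
  -- first configuration of height suc m; from there it either stays above that level to the end, or
  -- drops below it, and then the peak lies either before the drop or after it (recurse on the rest).
  levelSegment : ∀ m k {c₁ es cs c₂} → Acc _<_ (length es) → Run c₁ es cs c₂ →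
    height c₁ ≤ suc m → height c₂ ≤ suc m → Reaches (suc m + k) (c₁ ∷ cs) → HighSegment c₁ es c₂ m k
  levelSegment m k {⟨ x ∷ l , q ⟩} (acc rs) r h₁ h₂ peak with m≤n⇒m<n∨m≡n h₁
  levelSegment m k (acc rs) r h₁ h₂ (here p) | inj₁ below =
    ⊥-elim (<⇒≱ below (≤-trans (m≤m+n (suc m) k) p))
  levelSegment m k (acc rs) (next s r) h₁ h₂ (there p) | inj₁ (s≤s below) =
    high-prefix (next s done) (levelSegment m k (rs ≤-refl) r (≤-trans (step-height s) (s≤s below)) h₂ p)
  levelSegment m k {⟨ x ∷ l , q ⟩} (acc rs) r h₁ h₂ peak | inj₂ refl with descent l x [] q r
  ... | stays {cs = cs₀} {c' = ⟨ y ∷ l' , q' ⟩} r'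
    with refl ← prefix-empty l' l (s≤s⁻¹ h₂) | refl ← run-bottom r' = record
      { segment = record
          { before = [] ; after = [] ; W = l ; csBefore = [] ; csAfter = []
          ; split = sym (++-identityʳ _) ; runBefore = done ; runAfter = done }
      ; base = refl ; coreRun = r' ; peak = reaches-unframe l refl (sg x q ∷ cs₀) peak }
  ... | exits {inside} {exit} {outside} {csIn} rIn sExit hExit rOut
    with refl ← run-bottom rIn | ++⁻ (map (frame l) (sg x q ∷ csIn)) peak
  ...   | inj₁ p = record
      { segment = record
          { before = [] ; after = exit ∷ outside ; W = l ; csBefore = [] ; csAfter = _
          ; split = refl ; runBefore = done ; runAfter = next sExit rOut }
      ; base = refl ; coreRun = rIn ; peak = reaches-unframe l refl (sg x q ∷ csIn) p }
  ...   | inj₂ p = high-prefix (run-frame l rIn) (high-prefix (next sExit done)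
      (levelSegment (length l) k (rs (length-suffix inside exit outside)) rOut
        (≤-trans (≤-reflexive hExit) (n≤1+n _)) h₂ p))

  data Chain : Sym → St → St → List Ed → ℕ → Set where
    innermost : ∀ {γ q q' core cs} → Run (sg γ q) core cs (sg γ q') → Chain γ q q' core zero
    enclosing : ∀ {γ q q' core cs δ p p' core' k} → Run (sg γ q) core cs (sg γ q') →
      (S : Segment (sg γ q) core (sg γ q') δ p p' core') → Strict S → Chain δ p p' core' k →
      Chain γ q q' core (suc k)

  chain-run : ∀ {γ q q' core k} → Chain γ q q' core k → Σ (List Cf) λ cs → Run (sg γ q) core cs (sg γ q')
  chain-run (innermost r) = _ , r
  chain-run (enclosing r _ _ _) = _ , r

  -- A well-matched stretch climbing to height k + 1 contains a chain of depth k: repeatedly pass to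
  -- the stretch at height 2 that climbs to the remaining height.
  chain : ∀ k {γ q q' core cs} → Run (sg γ q) core cs (sg γ q') → Reaches (suc k) (sg γ q ∷ cs) →
    Chain γ q q' core k
  chain zero r _ = innermost r
  chain (suc k) r peak = enclosing r segment (strict-above segment base) (chain k coreRun peak₁)
    where
      open HighSegment (levelSegment 1 k (<-wellFounded _) r (s≤s z≤n) (s≤s z≤n) peak)
        renaming (peak to peak₁)

  M : ℕ
  M = nQ A * nΓ A * nQ A

  code : Sym → St → St → Fin M
  code γ q q' = combine (combine q γ) q'

  code-injective : ∀ {γ q q' δ p p'} → code γ q q' ≡ code δ p p' → γ ≡ δ × q ≡ p × q' ≡ p'
  code-injective {γ} {q} {q'} {δ} {p} {p'} same with combine-injective (combine q γ) q' (combine p δ) p' same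
  ... | outer≡ , refl with combine-injective q γ p δ outer≡
  ...   | refl , refl = refl , refl , refl

  levels : ∀ {γ q q' core k} → Chain γ q q' core k → Vec (Fin M) (suc k)
  levels {γ} {q} {q'} (innermost _) = code γ q q' ∷ []
  levels {γ} {q} {q'} (enclosing _ _ _ ch) = code γ q q' ∷ levels ch

  -- There are states and stack symbols, and M ≤ (|Q|·|Γ|)² since |Γ| ≥ 1.
  M-positive : St → Sym → 1 ≤ M
  M-positive q γ = *-mono-≤ (*-mono-≤ (fin-pos q) (fin-pos γ)) (fin-pos q)

  M-bound : M ≤ (nQ A * nΓ A) ^ 2
  M-bound = begin
    nQ A * nΓ A * nQ A           ≤⟨ *-monoʳ-≤ (nQ A * nΓ A) (m≤m*n (nQ A) (nΓ A) {{nonZeroIndex (bot A)}}) ⟩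
    nQ A * nΓ A * (nQ A * nΓ A)  ≡⟨ cong (nQ A * nΓ A *_) (sym (*-identityʳ (nQ A * nΓ A))) ⟩
    (nQ A * nΓ A) ^ 2            ∎
    where open ≤-Reasoning

  -- A pump of the run from c₁ along es to c₂: a stretch (the outer segment) that contains, strictly
  -- inside it, a stretch (inner) of the very same level.
  record Pump (c₁ : Cf) (es : List Ed) (c₂ : Cf) : Set where
    field
      {δ} : Sym
      {p p'} : St
      {core inner} : List Ed
      {innerConfigs} : List Cf
      outer : Segment c₁ es c₂ δ p p' core
      loop : Segment (sg δ p) core (sg δ p') δ p p' inner
      loopStrict : Strict loop
      innerRun : Run (sg δ p) inner innerConfigs (sg δ p')

  extend : ∀ {c₁ es c₂ γ q q' core} → Segment c₁ es c₂ γ q q' core → Pump (sg γ q) core (sg γ q') →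
    Pump c₁ es c₂
  extend S X = record { outer = S ⨾ outer ; loop = loop ; loopStrict = loopStrict ; innerRun = innerRun }
    where open Pump X

  locate : ∀ {γ q q' core δ p p' core' k} (S : Segment (sg γ q) core (sg γ q') δ p p' core') → Strict S →
    (ch : Chain δ p p' core' k) → Pump (sg γ q) core (sg γ q') ⊎ VecAll.All (code γ q q' ≢_) (levels ch)
  locate {γ} {q} {q'} {δ = δ} {p} {p'} S strict ch with code γ q q' ≟ code δ p p'
  ... | yes same with refl , refl , refl ← code-injective same =
    inj₁ (record { outer = whole ; loop = S ; loopStrict = strict ; innerRun = proj₂ (chain-run ch) })
  ... | no differ with ch
  ...   | innermost _ = inj₂ (differ ∷ [])
  ...   | enclosing _ T strictT ch' with locate (S ⨾ T) (strict-⨾ S T strictT) ch'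
  ...     | inj₁ X = inj₁ X
  ...     | inj₂ rest = inj₂ (differ ∷ rest)

  search : ∀ {γ q q' core k} (ch : Chain γ q q' core k) → Pump (sg γ q) core (sg γ q') ⊎ Unique (levels ch)
  search (innermost _) = inj₂ ([] ∷ [])
  search (enclosing _ S strict ch) with locate S strict ch
  ... | inj₁ X = inj₁ X
  ... | inj₂ fresh with search ch
  ...   | inj₁ X = inj₁ (extend S X)
  ...   | inj₂ distinct = inj₂ (fresh ∷ distinct)

  repetition : ∀ {γ q q' core k} → Chain γ q q' core k → M < suc k → Pump (sg γ q) core (sg γ q')
  repetition ch M<k with search ch
  ... | inj₁ X = X
  ... | inj₂ distinct = ⊥-elim (unique-short distinct M<k)

  -- A run climbing d ≥ M above its endpoints has a pump: the well-matched stretch at the height of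
  -- the higher endpoint that contains the peak reaches d + 1 on its own, so its chain has d + 1 > M
  -- levels.
  pump-exists : ∀ {c₁ es cs c₂} → Run c₁ es cs c₂ → M ≤ ASH A c₁ es → Pump c₁ es c₂
  pump-exists {⟨ x ∷ l , q ⟩} {es} {cs} {⟨ _ ∷ l' , _ ⟩} r many =
    extend segment (repetition (chain (ASH A _ es) coreRun peak) (s≤s many))
    where
      open HighSegment (levelSegment (length l ⊔ length l') (ASH A _ es) (<-wellFounded _) r
        (s≤s (m≤m⊔n _ _)) (s≤s (m≤n⊔m _ _)) (peak-of r (≤-trans (M-positive q x) many)))

  pump-up : ∀ {δ p P csP Z} → Run (sg δ p) P csP ⟨ δ ∷ Z , p ⟩ →
    ∀ j V → Σ (List Cf) λ cs → Run ⟨ δ ∷ V , p ⟩ (rep j P) cs ⟨ δ ∷ rep j Z ++ V , p ⟩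
  pump-up runP zero V = [] , done
  pump-up {δ} {p} {Z = Z} runP (suc j) V =
    _ , (run-frame V runP ++ᴿ subst (λ t → Run _ _ (proj₁ (pump-up runP j (Z ++ V))) ⟨ δ ∷ t , p ⟩) shift
                                   (proj₂ (pump-up runP j (Z ++ V))))
    where
      shift : rep j Z ++ Z ++ V ≡ (Z ++ rep j Z) ++ V
      shift = trans (sym (++-assoc (rep j Z) Z V)) (cong (_++ V) (rep-comm j Z))

  pump-down : ∀ {δ p' S csS Z} → Run ⟨ δ ∷ Z , p' ⟩ S csS (sg δ p') →
    ∀ j V → Σ (List Cf) λ cs → Run ⟨ δ ∷ rep j Z ++ V , p' ⟩ (rep j S) cs ⟨ δ ∷ V , p' ⟩
  pump-down runS zero V = [] , done
  pump-down {δ} {p'} {csS = csS} {Z} runS (suc j) V =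
    _ , subst (λ t → Run ⟨ δ ∷ t , p' ⟩ _ (map (frame (rep j Z ++ V)) csS ++ proj₁ (pump-down runS j V)) _)
              (sym (++-assoc Z (rep j Z) V))
              (run-frame (rep j Z ++ V) runS ++ᴿ proj₂ (pump-down runS j V))

  weight-++ : ∀ xs ys → weight A (xs ++ ys) ≡ weight A xs +ℤ weight A ys
  weight-++ [] ys = sym (ℤ.+-identityˡ _)
  weight-++ (x ∷ xs) ys = trans (cong (w A x +ℤ_) (weight-++ xs ys)) (sym (ℤ.+-assoc (w A x) _ _))

  maxHeight-++ : ∀ (xs ys : List Cf) → maxHeight (xs ++ ys) ≡ maxHeight xs ⊔ maxHeight ys
  maxHeight-++ [] ys = refl
  maxHeight-++ (x ∷ xs) ys =
    trans (cong (height x ⊔_) (maxHeight-++ xs ys)) (sym (⊔-assoc (height x) (maxHeight xs) (maxHeight ys)))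

  maxHeight-++-mono : ∀ (xs xs' ys ys' : List Cf) →
    maxHeight xs ≤ maxHeight xs' → maxHeight ys ≤ maxHeight ys' → maxHeight (xs ++ ys) ≤ maxHeight (xs' ++ ys')
  maxHeight-++-mono xs xs' ys ys' le le' =
    subst₂ _≤_ (sym (maxHeight-++ xs ys)) (sym (maxHeight-++ xs' ys')) (⊔-mono-≤ le le')

  maxHeight-inflate : ∀ (xs ys : List Cf) → maxHeight ys ≤ maxHeight (xs ++ ys)
  maxHeight-inflate [] ys = ≤-refl
  maxHeight-inflate (x ∷ xs) ys = ≤-trans (maxHeight-inflate xs ys) (m≤n⊔m (height x) _)

  maxHeight-frame : ∀ {ys ys'} → length ys ≤ length ys' → ∀ cs →
    maxHeight (map (frame ys) cs) ≤ maxHeight (map (frame ys') cs)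
  maxHeight-frame le [] = ≤-refl
  maxHeight-frame {ys} {ys'} le (c ∷ cs) = ⊔-mono-≤ raised (maxHeight-frame le cs)
    where
      raised : height (frame ys c) ≤ height (frame ys' c)
      raised = subst₂ _≤_ (sym (height-frame ys c)) (sym (height-frame ys' c)) (+-monoʳ-≤ (height c) le)

  module Pumping {c₁ es c₂} (X : Pump c₁ es c₂) where
    open Pump X
    open Segment outer public using (split)
      renaming (before to a; after to r; W to W; csBefore to csA; csAfter to csR; runBefore to runA; runAfter to runR)
    open Segment loop public using ()
      renaming (split to split₁; before to P; after to S; W to Z; csBefore to csP; csAfter to csS;
                runBefore to runP; runAfter to runS)

    decomposition : es ≡ a ++ P ++ inner ++ S ++ r
    decomposition = nest-split a P inner S r split split₁

    pumped : ℕ → List Ed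
    pumped j = a ++ rep j P ++ inner ++ rep j S ++ r

    pumped-run : ∀ j → Σ (List Cf) λ cs → Run c₁ (pumped j) cs c₂
    pumped-run j = _ , (runA ++ᴿ (proj₂ (pump-up runP j W) ++ᴿ
                         (run-frame (rep j Z ++ W) innerRun ++ᴿ (proj₂ (pump-down runS j W) ++ᴿ runR))))

    pumped-edges : All (_∈ E A) es → ∀ j → All (_∈ E A) (pumped j)
    pumped-edges edges j with All-++⁻ a (subst (All _) decomposition edges)
    ... | ea , rest with All-++⁻ P rest
    ... | eP , rest₁ with All-++⁻ inner rest₁
    ... | ei , rest₂ with All-++⁻ S rest₂
    ... | eS , er = ++⁺ ea (++⁺ (rep-all j eP) (++⁺ ei (++⁺ (rep-all j eS) er)))

    pumpable : All (_∈ E A) es → PumpablePair A c₁ es P S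
    pumpable edges = a , inner , r , decomposition , proj₁ loopStrict , proj₂ loopStrict ,
      λ j → pumped-edges edges j , _ , run-trace (proj₂ (pumped-run j))

    shrunk : List Ed
    shrunk = pumped 0

    shrunk-run : Run c₁ shrunk (csA ++ map (frame W) innerConfigs ++ csR) c₂
    shrunk-run = runA ++ᴿ (run-frame W innerRun ++ᴿ runR)

    original-run : Run c₁ (a ++ P ++ inner ++ S ++ r)
      (csA ++ map (frame W) csP ++ map (frame (Z ++ W)) innerConfigs ++ map (frame W) csS ++ csR) c₂
    original-run = runA ++ᴿ (run-frame W runP ++ᴿ (run-frame (Z ++ W) innerRun ++ᴿ (run-frame W runS ++ᴿ runR)))

    shrunk-path : All (_∈ E A) es → PathFromTo A c₁ shrunk c₂
    shrunk-path edges = run⇒path (pumped-edges edges 0) shrunk-run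

    shrunk-shorter : length shrunk < length es
    shrunk-shorter = subst (λ t → length shrunk < length t) (sym decomposition)
      (insert-< a P inner S r (proj₁ loopStrict))

    shrunk-weight : weight A es ≡ weight A shrunk +ℤ (weight A P +ℤ weight A S)
    shrunk-weight rewrite decomposition
      | weight-++ a (P ++ inner ++ S ++ r) | weight-++ P (inner ++ S ++ r) | weight-++ inner (S ++ r)
      | weight-++ S r | weight-++ a (inner ++ r) | weight-++ inner r =
      pump-weight (weight A a) (weight A P) (weight A inner) (weight A S) (weight A r)

    -- Removing the two blocks cannot make the path climb higher: every configuration of the shrunk
    -- run also occurs in the original run, or lies below one (inner sits on a lower frame).
    shrunk-ASH : ASH A c₁ shrunk ≤ ASH A c₁ es
    shrunk-ASH = begin
      ASH A c₁ shrunk                         ≡⟨ run-ASH shrunk-run ⟩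
      maxHeight (c₁ ∷ csA ++ middle) ∸ ends    ≤⟨ ∸-monoˡ-≤ ends (⊔-monoʳ-≤ (height c₁) lower) ⟩
      maxHeight (c₁ ∷ csA ++ middle') ∸ ends   ≡⟨ sym (run-ASH original-run) ⟩
      ASH A c₁ (a ++ P ++ inner ++ S ++ r)    ≡⟨ cong (ASH A c₁) (sym decomposition) ⟩
      ASH A c₁ es                             ∎
      where
        open ≤-Reasoning
        ends = height c₁ ⊔ height c₂
        middle = map (frame W) innerConfigs ++ csR
        middle' = map (frame W) csP ++ map (frame (Z ++ W)) innerConfigs ++ map (frame W) csS ++ csR
        lower : maxHeight (csA ++ middle) ≤ maxHeight (csA ++ middle')
        lower = maxHeight-++-mono csA csA middle middle' ≤-refl
          (≤-trans (maxHeight-++-mono (map (frame W) innerConfigs) (map (frame (Z ++ W)) innerConfigs)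
                                      csR (map (frame W) csS ++ csR)
                                      (maxHeight-frame {W} {Z ++ W} (length-++-≤ʳ W {Z}) innerConfigs)
                                      (maxHeight-inflate (map (frame W) csS) csR))
                   (maxHeight-inflate (map (frame W) csP) _))

  module Minimal (c₁ c₂ : Cf) (n : ℤ) (d : ℕ)
      (minimal : ∀ es → PathFromTo A c₁ es c₂ → n ≤ℤ weight A es → d ≤ ASH A c₁ es) (many : M ≤ d) where

    record Witness (es : List Ed) : Set where
      field
        path : PathFromTo A c₁ es c₂
        heavy : n ≤ℤ weight A es
        ash≡d : ASH A c₁ es ≡ d

    Shorter : List Ed → Set
    Shorter es = Σ (List Ed) λ es' → length es' < length es × Witness es'

    Goal : Set
    Goal = ∃[ π ] (PathFromTo A c₁ π c₂ × ASH A c₁ π ≡ d ×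
      ∃[ p₁ ] ∃[ p₂ ] (PumpablePair A c₁ π p₁ p₂ × 0ℤ <ℤ weight A p₁ +ℤ weight A p₂))

    -- A pump of a witness either has positive weight, or removing it leaves a shorter witness: the
    -- weight does not drop, and the ASH neither rises nor, by minimality, drops below d.
    module UsePump {es} (wit : Witness es) (X : Pump c₁ es c₂) where
      open Witness wit
      open Pumping X

      shrunk-witness : ¬ 0ℤ <ℤ weight A P +ℤ weight A S → Witness shrunk
      shrunk-witness nonpositive = record { path = shrunk-path (proj₁ path) ; heavy = lighter ; ash≡d = same }
        where
          lighter : n ≤ℤ weight A shrunk
          lighter = ℤ.≤-trans (subst (n ≤ℤ_) shrunk-weight heavy)
            (ℤ.≤-trans (ℤ.+-monoʳ-≤ (weight A shrunk) (ℤ.≮⇒≥ nonpositive)) (ℤ.≤-reflexive (ℤ.+-identityʳ _)))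
          same : ASH A c₁ shrunk ≡ d
          same = ≤-antisym (≤-trans shrunk-ASH (≤-reflexive ash≡d))
                           (minimal shrunk (shrunk-path (proj₁ path)) lighter)

      outcome : Goal ⊎ Shorter es
      outcome with 0ℤ ℤ.<? weight A P +ℤ weight A S
      ... | yes positive = inj₁ (es , path , ash≡d , P , S , pumpable (proj₁ path) , positive)
      ... | no nonpositive = inj₂ (shrunk , shrunk-shorter , shrunk-witness nonpositive)

    improve : ∀ {es} → Witness es → Goal ⊎ Shorter es
    improve wit = UsePump.outcome wit (pump-exists (proj₂ (path⇒run path)) (subst (M ≤_) (sym ash≡d) many))
      where open Witness wit

    pumped-witness : ∀ es → Acc _<_ (length es) → Witness es → Goal
    pumped-witness es (acc rs) wit with improve wit
    ... | inj₁ goal = goal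
    ... | inj₂ (es' , shorter , wit') = pumped-witness es' (rs shorter) wit'

open import Data.Nat using (ℕ; _*_; _^_; _≤_)
open import Data.Integer using (ℤ; _<_; _+_; 0ℤ)
open import Data.List using (List; length)
open import Data.Product using (∃-syntax; _×_; _,_)
open import Relation.Binary.PropositionalEquality using (_≡_)
open import Data.Nat.Properties using (≤-trans)
open import Data.Nat.Induction using (<-wellFounded)

lemma2 : (A : WPS) (c₁ c₂ : Config A) (n : ℤ) (d : ℕ) →
    IsMinASH A c₁ c₂ n d →
    (nQ A * nΓ A) ^ 2 ≤ d →
    ∃[ π ] (PathFromTo A c₁ π c₂ × ASH A c₁ π ≡ d ×
    ∃[ p₁ ] ∃[ p₂ ] (PumpablePair A c₁ π p₁ p₂ × 0ℤ < weight A p₁ + weight A p₂))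
lemma2 A c₁ c₂ n d ((π , path , heavy , ash≡d) , minimal) bound =
  pumped-witness π (<-wellFounded (length π)) (record { path = path ; heavy = heavy ; ash≡d = ash≡d })
  where
    open PushdownRuns A using (M-bound; module Minimal)
    open Minimal c₁ c₂ n d minimal (≤-trans M-bound bound)
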